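{- Let $H$ be a reflexive triangle-free graph. If $A_f$ and $B_f$ are free-reduced non-contractible closed walks in $H$ with $\langle A_f\rangle=\langle B_f\rangle$, then $B_f$ is a cyclic shift of $A_f$.
   Context: Walks in the reflexive graph $H$ are sequences $(x_0,\dots,x_\ell)$ of vertices with consecutive vertices adjacent (possibly equal); closed walks with basepoint $x_0=x_\ell$. A cyclic shift of a closed walk $(x_0,x_1,\dots,x_{\ell-1},x_0)$ is a closed walk $(x_j,x_{j+1},\dots,x_{\ell-1},x_0,\dots,x_j)$. $\Pi(H;a,b)$ is the graph on $(a,b)$-walks where $X=(x_0,\dots,x_\ell)$ and $Y$ are adjacent if (P1) $Y=(x_0,\dots,x_i,x_i,\dots,x_\ell)$, or (P2) $Y=(x_0,\dots,x_{i-1},x_i',x_{i+1},\dots,x_\ell)$ for some $0<i<\ell$ with $x_i'\sim x_i$ and $Y$ a walk (adjacency symmetric); a closed walk $D$ at $r$ is contractible if its component in $\Pi(H;r,r)$ contains the trivial walk $(r)$. $\Pi(H)$ is the graph obtained from the disjoint union over $r\in V(H)$ of $\Pi(H;r,r)$ by additionally joining $y$ and $x=(x_0,x_1,\dots,x_{\ell-1},x_0)$ whenever $x_1=x_{\ell-1}$ and $y=(x_1,\dots,x_{\ell-1})$. $\langle D\rangle$ denotes the component of $\Pi(H)$ containing $D$; $D$ is free-reduced if it is a shortest closed walk in $\langle D\rangle$. -}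

module Defs where

open import Data.Nat using (ℕ; _≤_)
open import Data.Fin using (Fin)
open import Data.Bool using (Bool; true)
open import Data.List using (List; []; _∷_; [_]; _++_; length)
open import Data.Product using (Σ; ∃; _×_; _,_)
open import Data.Sum using (_⊎_)
open import Data.Empty using (⊥)
open import Relation.Nullary using (¬_)
open import Relation.Binary.PropositionalEquality using (_≡_; _≢_)
open import Relation.Binary.Construct.Closure.ReflexiveTransitive using (Star)

record RGraph : Set where
  field
    n     : ℕ
    adj   : Fin n → Fin n → Bool
    adj-refl : ∀ x → adj x x ≡ true
    adj-sym  : ∀ x y → adj x y ≡ adj y x

module _ (H : RGraph) where
  open RGraph H

  V : Set
  V = Fin n

  _∼_ : V → V → Set
  x ∼ y = adj x y ≡ true

  TriangleFree : Set
  TriangleFree = ∀ x y z → x ≢ y → y ≢ z → x ≢ z →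
                 x ∼ y → y ∼ z → x ∼ z → ⊥

  data IsWalk : List V → Set where
    single : ∀ x → IsWalk [ x ]
    cons   : ∀ {x y xs} → x ∼ y → IsWalk (y ∷ xs) → IsWalk (x ∷ y ∷ xs)

  Starts : V → List V → Set
  Starts a X = ∃ λ ys → X ≡ a ∷ ys

  Ends : V → List V → Set
  Ends b X = ∃ λ ys → X ≡ ys ++ [ b ]

  IsWalkFrom : V → V → List V → Set
  IsWalkFrom a b X = IsWalk X × Starts a X × Ends b X

  IsClosedWalk : List V → Set
  IsClosedWalk X = ∃ λ r → IsWalkFrom r r X

  data Move : List V → List V → Set where
    P1 : ∀ p x q → Move (p ++ x ∷ q) (p ++ x ∷ x ∷ q)
    -- (P2) replace an interior vertex x_i (0 < i < ℓ) by an adjacent x_i'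
    P2 : ∀ y p x x' z q → x' ∼ x →
         Move ((y ∷ p) ++ x ∷ (z ∷ q)) ((y ∷ p) ++ x' ∷ (z ∷ q))

  PiAB : V → V → List V → List V → Set
  PiAB a b X Y = IsWalkFrom a b X × IsWalkFrom a b Y × (Move X Y ⊎ Move Y X)

  Contractible : List V → Set
  Contractible D = ∃ λ r → IsWalkFrom r r D × Star (PiAB r r) D [ r ]

  -- the extra edges of Π(H): x = (x₀,x₁,…,x_{ℓ-1},x₀) and y = (x₁,…,x_{ℓ-1}) with x₁ = x_{ℓ-1}
  Reduce : List V → List V → Set
  Reduce X Y = ∃ λ x₀ → X ≡ x₀ ∷ (Y ++ [ x₀ ]) × IsClosedWalk Y

  PiEdge : List V → List V → Set
  PiEdge X Y = IsClosedWalk X × IsClosedWalk Y ×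
               ((∃ λ r → PiAB r r X Y) ⊎ Reduce X Y ⊎ Reduce Y X)

  SameComponent : List V → List V → Set
  SameComponent X Y = Star PiEdge X Y

  -- free-reduced: a shortest closed walk in its component ⟨D⟩
  -- (length of a walk with k vertices is k - 1; comparing vertex counts is the same)
  FreeReduced : List V → Set
  FreeReduced D = IsClosedWalk D ×
    (∀ E → IsClosedWalk E → SameComponent D E → length D ≤ length E)

  -- B is a cyclic shift of the closed walk A = (x₀,…,x_{ℓ-1},x₀):
  -- A = (x₀,…,x_{j-1}) ++ (x_j,…,x_{ℓ-1}) ++ (x₀),  B = (x_j,…,x_{ℓ-1}) ++ (x₀,…,x_{j-1}) ++ (x_j)
  CyclicShift : List V → List V → Set
  CyclicShift A B = ∃ λ u → ∃ λ x → ∃ λ v → ∃ λ x₀ →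
    Starts x₀ A × A ≡ u ++ x ∷ v ++ [ x₀ ] × B ≡ x ∷ v ++ u ++ [ x ]

-- Read a closed walk as a word over V(H). Free reduction (x x ↦ x, a b a ↦ a), followed by cyclic
-- reduction and dropping the closing vertex, gives a word whose rotation class is invariant along the
-- edges of Π(H). A (P1) move only inserts a stutter. A (P2) move replaces x by a neighbour x′ inside
-- a x z; in a triangle-free graph a and z then both lie in {x, x′}, and the change cancels after
-- reduction. The extra edges of Π(H) conjugate the word by a letter, which changes its cyclic
-- reduction only by a rotation. A free-reduced non-contractible closed walk is already freely and
-- cyclically reduced, since each reduction would give a shorter walk in its component; so it is its
-- own invariant, and two such walks in one component are rotations of each other.

module Submission where

open import Data.Nat using (ℕ; zero; suc; _+_; _≤_; _<_; s≤s)
open import Data.Nat.Properties using (≤-trans; n≤1+n; ≤-refl; ≤⇒≯; +-monoʳ-<; n<1+n; m<n⇒m<1+n)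
open import Data.List using (List; []; _∷_; [_]; _++_; _∷ʳ_; length; foldr; initLast; _∷ʳ′_)
open import Data.List.Properties using (++-assoc; ∷ʳ-++; ++-conicalʳ; ++-identityʳ; foldr-++; ∷ʳ-injective; ∷ʳ-injectiveʳ; ∷-injective; ∷-injectiveˡ; ∷-injectiveʳ; ∷ʳ-injectiveˡ; length-++)
open import Data.Product using (∃; ∃₂; _×_; _,_; proj₁; proj₂)
open import Data.Sum using (_⊎_; inj₁; inj₂)
open import Data.Empty using (⊥-elim)
open import Data.Unit using (⊤; tt)
open import Relation.Nullary using (¬_; Dec; yes; no)
open import Relation.Binary.PropositionalEquality using (_≡_; _≢_; ≢-sym; refl; sym; trans; cong; subst; subst₂; module ≡-Reasoning)
open import Relation.Binary.Definitions using (DecidableEquality)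
open import Function using (_∘_)
open import Relation.Binary.Construct.Closure.ReflexiveTransitive using (ε; _◅_)
open import Data.Fin.Properties using () renaming (_≟_ to _≟ᶠ_)

open import Defs

module FreeReduction {A : Set} (_≟_ : DecidableEquality A) where

  Reduced : List A → Set
  Reduced []              = ⊤
  Reduced (x ∷ [])        = ⊤
  Reduced (x ∷ y ∷ [])    = x ≢ y
  Reduced (x ∷ y ∷ z ∷ r) = x ≢ y × x ≢ z × Reduced (y ∷ z ∷ r)

  reduced-∷⁻ : ∀ {x} L → Reduced (x ∷ L) → Reduced L
  reduced-∷⁻ []          _           = tt
  reduced-∷⁻ (y ∷ [])    _           = tt
  reduced-∷⁻ (y ∷ z ∷ r) (_ , _ , h) = h

  reduced-++⁻ˡ : ∀ P Q → Reduced (P ++ Q) → Reduced P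
  reduced-++⁻ˡ []              Q       _           = tt
  reduced-++⁻ˡ (x ∷ [])        Q       _           = tt
  reduced-++⁻ˡ (x ∷ y ∷ [])    []      h           = h
  reduced-++⁻ˡ (x ∷ y ∷ [])    (_ ∷ _) (h , _)     = h
  reduced-++⁻ˡ (x ∷ y ∷ z ∷ P) Q       (h , h′ , r) = h , h′ , reduced-++⁻ˡ (y ∷ z ∷ P) Q r

  reduced-extend : ∀ P {b c d} → Reduced (P ∷ʳ b ∷ʳ c) → b ≢ d → c ≢ d → Reduced (P ∷ʳ b ∷ʳ c ∷ʳ d)
  reduced-extend []              b≢c            b≢d c≢d = b≢c , b≢d , c≢d
  reduced-extend (x ∷ [])        (h , h′ , b≢c) b≢d c≢d = h , h′ , b≢c , b≢d , c≢d
  reduced-extend (x ∷ y ∷ [])    (h , h′ , r)   b≢d c≢d = h , h′ , reduced-extend (y ∷ []) r b≢d c≢d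
  reduced-extend (x ∷ y ∷ z ∷ P) (h , h′ , r)   b≢d c≢d = h , h′ , reduced-extend (y ∷ z ∷ P) r b≢d c≢d

  reduced-¬stutter : ∀ p {x q} → ¬ Reduced (p ++ x ∷ x ∷ q)
  reduced-¬stutter []      {q = []}    h = h refl
  reduced-¬stutter []      {q = _ ∷ _} h = proj₁ h refl
  reduced-¬stutter (c ∷ p)             h = reduced-¬stutter p (reduced-∷⁻ (p ++ _) h)

  reduced-¬backtrack : ∀ p {a b q} → ¬ Reduced (p ++ a ∷ b ∷ a ∷ q)
  reduced-¬backtrack []      h = proj₁ (proj₂ h) refl
  reduced-¬backtrack (c ∷ p) h = reduced-¬backtrack p (reduced-∷⁻ (p ++ _) h)

  reduced-intro : ∀ L → (∀ p x q → L ≢ p ++ x ∷ x ∷ q) → (∀ p a b q → L ≢ p ++ a ∷ b ∷ a ∷ q) → Reduced L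
  reduced-intro []              _  _  = tt
  reduced-intro (x ∷ [])        _  _  = tt
  reduced-intro (x ∷ y ∷ [])    ns _  refl = ns [] x [] refl
  reduced-intro (x ∷ y ∷ z ∷ r) ns nb =
    (λ { refl → ns [] x (z ∷ r) refl }) ,
    (λ { refl → nb [] x y r refl }) ,
    reduced-intro (y ∷ z ∷ r) (λ p w q e → ns (x ∷ p) w q (cong (x ∷_) e))
                              (λ p a b q e → nb (x ∷ p) a b q (cong (x ∷_) e))

  pushPast : A → A → List A → List A
  pushPast x y []      = x ∷ y ∷ []
  pushPast x y (z ∷ r) with x ≟ z
  ... | yes _ = z ∷ r
  ... | no  _ = x ∷ y ∷ z ∷ r

  push : A → List A → List A
  push x []      = x ∷ []
  push x (y ∷ r) with x ≟ y
  ... | yes _ = y ∷ r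
  ... | no  _ = pushPast x y r

  push-≡ : ∀ x r → push x (x ∷ r) ≡ x ∷ r
  push-≡ x r with x ≟ x
  ... | yes _   = refl
  ... | no  x≢x = ⊥-elim (x≢x refl)

  push-≢ : ∀ {x y} r → x ≢ y → push x (y ∷ r) ≡ pushPast x y r
  push-≢ {x} {y} r x≢y with x ≟ y
  ... | yes x≡y = ⊥-elim (x≢y x≡y)
  ... | no  _   = refl

  pushPast-≡ : ∀ x y r → pushPast x y (x ∷ r) ≡ x ∷ r
  pushPast-≡ x y r with x ≟ x
  ... | yes _   = refl
  ... | no  x≢x = ⊥-elim (x≢x refl)

  pushPast-≢ : ∀ {x z} y r → x ≢ z → pushPast x y (z ∷ r) ≡ x ∷ y ∷ z ∷ r
  pushPast-≢ {x} {z} y r x≢z with x ≟ z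
  ... | yes x≡z = ⊥-elim (x≢z x≡z)
  ... | no  _   = refl

  push-∷-∷ : ∀ {x₀ x₁ a} R → x₀ ≢ x₁ → x₀ ≢ a → push x₀ (x₁ ∷ a ∷ R) ≡ x₀ ∷ x₁ ∷ a ∷ R
  push-∷-∷ {x₁ = x₁} R x₀≢x₁ x₀≢a = trans (push-≢ _ x₀≢x₁) (pushPast-≢ x₁ R x₀≢a)

  push-backtrack-∷-∷ : ∀ {x₁ a} R → a ≢ x₁ → push a (x₁ ∷ a ∷ R) ≡ a ∷ R
  push-backtrack-∷-∷ {x₁} {a} R a≢x₁ = trans (push-≢ _ a≢x₁) (pushPast-≡ a x₁ R)

  push-head : ∀ x r → ∃ λ t → push x r ≡ x ∷ t
  push-head x [] = [] , refl
  push-head x (y ∷ r) with x ≟ y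
  push-head x (x ∷ r)     | yes refl = r , refl
  push-head x (y ∷ [])    | no  _    = y ∷ [] , refl
  push-head x (y ∷ z ∷ r) | no  _ with x ≟ z
  ... | yes refl = r , refl
  ... | no  _    = y ∷ z ∷ r , refl

  push-reduced : ∀ x r → Reduced r → Reduced (push x r)
  push-reduced x []      _ = tt
  push-reduced x (y ∷ r) h with x ≟ y
  push-reduced x (x ∷ r)     h | yes refl = h
  push-reduced x (y ∷ [])    h | no x≢y   = x≢y
  push-reduced x (y ∷ z ∷ r) h | no x≢y with x ≟ z
  ... | yes refl = reduced-∷⁻ (x ∷ r) h
  ... | no  x≢z  = x≢y , x≢z , h

  push-∷-reduced : ∀ x u → Reduced (x ∷ u) → push x u ≡ x ∷ u
  push-∷-reduced x []          _             = refl
  push-∷-reduced x (y ∷ [])    x≢y           = push-≢ [] x≢y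
  push-∷-reduced x (y ∷ z ∷ u) (x≢y , x≢z , _) = trans (push-≢ (z ∷ u) x≢y) (pushPast-≢ y u x≢z)

  push-idem : ∀ x r → push x (push x r) ≡ push x r
  push-idem x r with push-head x r
  ... | t , eq rewrite eq = push-≡ x t

  push-backtrack-∷ : ∀ x y t → Reduced (x ∷ t) → push x (push y (x ∷ t)) ≡ x ∷ t
  push-backtrack-∷ x y t h with y ≟ x
  push-backtrack-∷ x x t h       | yes refl = push-≡ x t
  push-backtrack-∷ x y [] h      | no y≢x   = trans (push-≢ (x ∷ []) (≢-sym y≢x)) (pushPast-≡ x y [])
  push-backtrack-∷ x y (z ∷ t) h | no y≢x with y ≟ z
  ... | yes refl = push-∷-reduced x (y ∷ t) h
  ... | no  _    = trans (push-≢ (x ∷ z ∷ t) (≢-sym y≢x)) (pushPast-≡ x y (z ∷ t))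

  push-backtrack : ∀ x y s → Reduced s → push x (push y (push x s)) ≡ push x s
  push-backtrack x y s h with push-head x s | push-reduced x s h
  ... | t , eq | h′ rewrite eq = push-backtrack-∷ x y t h′

  push-replace-middle : ∀ {a x x′ z} r → Reduced r → a ≡ x ⊎ a ≡ x′ → z ≡ x ⊎ z ≡ x′ →
                        push a (push x (push z r)) ≡ push a (push x′ (push z r))
  push-replace-middle {x = x} {x′} r h (inj₁ refl) (inj₁ refl) =
    trans (push-idem x (push x r)) (trans (push-idem x r) (sym (push-backtrack x x′ r h)))
  push-replace-middle {x = x} {x′} r h (inj₁ refl) (inj₂ refl) =
    trans (push-idem x (push x′ r)) (cong (push x) (sym (push-idem x′ r)))
  push-replace-middle {x = x} {x′} r h (inj₂ refl) (inj₁ refl) =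
    trans (cong (push x′) (push-idem x r)) (sym (push-idem x′ (push x r)))
  push-replace-middle {x = x} {x′} r h (inj₂ refl) (inj₂ refl) =
    trans (push-backtrack x′ x r h) (sym (trans (push-idem x′ (push x′ r)) (push-idem x′ r)))

  reduce : List A → List A
  reduce = foldr push []

  pushAll : List A → List A → List A
  pushAll s t = foldr push t s

  pushAll-∷ʳ : ∀ s x t → pushAll (s ∷ʳ x) t ≡ pushAll s (push x t)
  pushAll-∷ʳ s x t = foldr-++ push t s [ x ]

  reduce-++ : ∀ s t → reduce (s ++ t) ≡ pushAll s (reduce t)
  reduce-++ s t = foldr-++ push [] s t

  pushAll-reduced : ∀ s t → Reduced t → Reduced (pushAll s t)
  pushAll-reduced []      t h = h
  pushAll-reduced (x ∷ s) t h = push-reduced x (pushAll s t) (pushAll-reduced s t h)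

  reduce-reduced : ∀ s → Reduced (reduce s)
  reduce-reduced s = pushAll-reduced s [] tt

  push-pushAll : ∀ x u t → Reduced u → Reduced t → push x (pushAll u t) ≡ pushAll (push x u) t
  push-pushAll x []      t _  _  = refl
  push-pushAll x (y ∷ u) t hu ht with x ≟ y
  push-pushAll x (x ∷ u)     t hu ht | yes refl = push-idem x (pushAll u t)
  push-pushAll x (y ∷ [])    t hu ht | no _     = refl
  push-pushAll x (y ∷ z ∷ u) t hu ht | no _ with x ≟ z
  ... | yes refl = push-backtrack x y (pushAll u t) (pushAll-reduced u t ht)
  ... | no  _    = refl

  pushAll-reduce : ∀ s t → Reduced t → pushAll s t ≡ pushAll (reduce s) t
  pushAll-reduce []      t h = refl
  pushAll-reduce (x ∷ s) t h =
    trans (cong (push x) (pushAll-reduce s t h)) (push-pushAll x (reduce s) t (reduce-reduced s) h)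

  pushAll-of-reduced : ∀ R t → Reduced (R ++ t) → pushAll R t ≡ R ++ t
  pushAll-of-reduced []      t h = refl
  pushAll-of-reduced (x ∷ R) t h =
    trans (cong (push x) (pushAll-of-reduced R t (reduced-∷⁻ (R ++ t) h))) (push-∷-reduced x (R ++ t) h)

  reduce-of-reduced : ∀ R → Reduced R → reduce R ≡ R
  reduce-of-reduced R h = trans (pushAll-of-reduced R [] (subst Reduced (sym (++-identityʳ R)) h)) (++-identityʳ R)

  push-last : ∀ x {c} u ws → u ≡ ws ∷ʳ c → ∃ λ ws′ → push x u ≡ ws′ ∷ʳ c
  push-last x []      []          ()
  push-last x []      (_ ∷ _)     ()
  push-last x (y ∷ r) ws eq with x ≟ y
  ... | yes _ = ws , eq
  ... | no  _ = pushPast-last r ws eq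
    where
    pushPast-last : ∀ {c} r ws → y ∷ r ≡ ws ∷ʳ c → ∃ λ ws′ → pushPast x y r ≡ ws′ ∷ʳ c
    pushPast-last []       []            refl = x ∷ [] , refl
    pushPast-last []       (_ ∷ [])      ()
    pushPast-last []       (_ ∷ _ ∷ _)   ()
    pushPast-last (z ∷ r′) ws eq with x ≟ z
    pushPast-last (z ∷ r′) []         () | yes _
    pushPast-last (z ∷ r′) (_ ∷ ws′) eq | yes _ = ws′ , proj₂ (∷-injective eq)
    pushPast-last (z ∷ r′) ws        eq | no  _ = x ∷ ws , cong (x ∷_) eq

  reduce-last : ∀ zs c → ∃ λ ws → reduce (zs ∷ʳ c) ≡ ws ∷ʳ c
  reduce-last []       c = [] , refl
  reduce-last (z ∷ zs) c with reduce-last zs c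
  ... | ws , eq = push-last z (reduce (zs ∷ʳ c)) ws eq

  -- Cyclic reduction of a reduced closed word: (x₀ x₁ … x₁ y₀) is trimmed to (x₁ … x₁).
  Trimmable : List A → Set
  Trimmable L = ∃₂ λ x₀ x₁ → ∃₂ λ M y₀ → L ≡ x₀ ∷ x₁ ∷ M ∷ʳ x₁ ∷ʳ y₀

  trimmable-inner : ∀ z R w → Trimmable (z ∷ R ∷ʳ w) → ∃₂ λ y N → R ≡ y ∷ N ∷ʳ y
  trimmable-inner z R w (_ , y , N , _ , eq) = y , N , ∷ʳ-injectiveˡ R (y ∷ N ∷ʳ y) (∷-injectiveʳ eq)

  trimmable-ends : ∀ {x₀ x₁ M y₁ y₀} → Trimmable (x₀ ∷ x₁ ∷ M ∷ʳ y₁ ∷ʳ y₀) → x₁ ≡ y₁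
  trimmable-ends {x₁ = x₁} {M} {y₁} t with trimmable-inner _ (x₁ ∷ M ∷ʳ y₁) _ t
  ... | y , N , eq with ∷-injective eq
  ... | refl , eq′ = sym (∷ʳ-injectiveʳ M N eq′)

  trimmable? : ∀ L → Dec (Trimmable L)
  trimmable? []            = no λ { (_ , _ , _ , _ , ()) }
  trimmable? (x₀ ∷ [])     = no λ { (_ , _ , _ , _ , ()) }
  trimmable? (x₀ ∷ x₁ ∷ R) with initLast R
  ... | [] = no λ { (_ , _ , [] , _ , ()) ; (_ , _ , _ ∷ _ , _ , ()) }
  ... | R′ ∷ʳ′ y₀ with initLast R′
  ...   | [] = no λ { (_ , _ , [] , _ , ()) ; (_ , _ , _ ∷ [] , _ , ()) ; (_ , _ , _ ∷ _ ∷ _ , _ , ()) }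
  ...   | M ∷ʳ′ y₁ with x₁ ≟ y₁
  ...     | yes refl = yes (x₀ , x₁ , M , y₀ , refl)
  ...     | no x₁≢y₁ = no (x₁≢y₁ ∘ trimmable-ends)

  trimWith : ℕ → List A → List A
  trimWith zero    L = L
  trimWith (suc f) L with trimmable? L
  ... | yes (_ , x₁ , M , _ , _) = trimWith f (x₁ ∷ M ∷ʳ x₁)
  ... | no _                     = L

  trimWith-stop : ∀ f L → ¬ Trimmable L → trimWith f L ≡ L
  trimWith-stop zero    L _ = refl
  trimWith-stop (suc f) L ¬t with trimmable? L
  ... | yes t = ⊥-elim (¬t t)
  ... | no  _ = refl

  trimWith-step : ∀ f x₀ x₁ M y₀ → trimWith (suc f) (x₀ ∷ x₁ ∷ M ∷ʳ x₁ ∷ʳ y₀) ≡ trimWith f (x₁ ∷ M ∷ʳ x₁)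
  trimWith-step f x₀ x₁ M y₀ with trimmable? (x₀ ∷ x₁ ∷ M ∷ʳ x₁ ∷ʳ y₀)
  ... | no ¬t = ⊥-elim (¬t (x₀ , x₁ , M , y₀ , refl))
  ... | yes (_ , _ , N , _ , eq) with ∷-injective eq
  ... | _ , eq′ with ∷-injective eq′
  ... | refl , eq″ with ∷ʳ-injective M N (proj₁ (∷ʳ-injective _ _ eq″))
  ... | refl , _ = refl

  length-∷ʳ : ∀ (xs : List A) x → length (xs ∷ʳ x) ≡ suc (length xs)
  length-∷ʳ []       x = refl
  length-∷ʳ (_ ∷ xs) x = cong suc (length-∷ʳ xs x)

  length-trimmed≤ : ∀ {k} x₁ M y₀ → length (x₁ ∷ M ∷ʳ x₁ ∷ʳ y₀) ≤ k → length (x₁ ∷ M ∷ʳ x₁) ≤ k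
  length-trimmed≤ {k} x₁ M y₀ h = ≤-trans (n≤1+n _) (subst (_≤ k) (cong suc (length-∷ʳ (M ∷ʳ x₁) y₀)) h)

  -- The fuel only has to exceed the length, since each trimming step shortens the word.
  trimWith-fuel : ∀ f g L → length L ≤ f → length L ≤ g → trimWith f L ≡ trimWith g L
  trimWith-fuel f g L hf hg with trimmable? L
  ... | no ¬t = trans (trimWith-stop f L ¬t) (sym (trimWith-stop g L ¬t))
  ... | yes (x₀ , x₁ , M , y₀ , refl) = go f g hf hg
    where
    go : ∀ f g → length (x₀ ∷ x₁ ∷ M ∷ʳ x₁ ∷ʳ y₀) ≤ f → length (x₀ ∷ x₁ ∷ M ∷ʳ x₁ ∷ʳ y₀) ≤ g →
         trimWith f (x₀ ∷ x₁ ∷ M ∷ʳ x₁ ∷ʳ y₀) ≡ trimWith g (x₀ ∷ x₁ ∷ M ∷ʳ x₁ ∷ʳ y₀)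
    go (suc f) (suc g) (s≤s hf) (s≤s hg) = begin
      trimWith (suc f) (x₀ ∷ x₁ ∷ M ∷ʳ x₁ ∷ʳ y₀) ≡⟨ trimWith-step f x₀ x₁ M y₀ ⟩
      trimWith f (x₁ ∷ M ∷ʳ x₁)                  ≡⟨ trimWith-fuel f g _ (length-trimmed≤ x₁ M y₀ hf)
                                                                          (length-trimmed≤ x₁ M y₀ hg) ⟩
      trimWith g (x₁ ∷ M ∷ʳ x₁)                  ≡⟨ trimWith-step g x₀ x₁ M y₀ ⟨
      trimWith (suc g) (x₀ ∷ x₁ ∷ M ∷ʳ x₁ ∷ʳ y₀) ∎
      where open ≡-Reasoning

  trim : List A → List A
  trim L = trimWith (length L) L

  trim-stop : ∀ L → ¬ Trimmable L → trim L ≡ L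
  trim-stop L = trimWith-stop (length L) L

  trim-step : ∀ x₀ x₁ M y₀ → trim (x₀ ∷ x₁ ∷ M ∷ʳ x₁ ∷ʳ y₀) ≡ trim (x₁ ∷ M ∷ʳ x₁)
  trim-step x₀ x₁ M y₀ =
    trans (trimWith-step _ x₀ x₁ M y₀)
          (trimWith-fuel _ _ (x₁ ∷ M ∷ʳ x₁) (length-trimmed≤ x₁ M y₀ ≤-refl) ≤-refl)

  Rotation : List A → List A → Set
  Rotation L L′ = ∃₂ λ u v → L ≡ u ++ v × L′ ≡ v ++ u

  rotate : ℕ → List A → List A
  rotate zero    L       = L
  rotate (suc k) []      = []
  rotate (suc k) (x ∷ L) = rotate k (L ∷ʳ x)

  rotation-rotate : ∀ k L → Rotation L (rotate k L)
  rotation-rotate zero    L       = [] , L , refl , sym (++-identityʳ L)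
  rotation-rotate (suc k) []      = [] , [] , refl , refl
  rotation-rotate (suc k) (x ∷ L) with rotation-rotate k (L ∷ʳ x)
  ... | u , v , eq , eq′ with initLast v
  ... | [] = x ∷ [] , L , refl , trans eq′ (sym (trans eq (++-identityʳ u)))
  ... | v′ ∷ʳ′ y with ∷ʳ-injective L (u ++ v′) (trans eq (sym (++-assoc u v′ [ y ])))
  ...   | refl , refl = x ∷ u , v′ , refl , trans eq′ (++-assoc v′ [ x ] u)

  rotate-++ : ∀ u v → rotate (length u) (u ++ v) ≡ v ++ u
  rotate-++ []      v = sym (++-identityʳ v)
  rotate-++ (c ∷ u) v = begin
    rotate (length u) ((u ++ v) ∷ʳ c) ≡⟨ cong (rotate (length u)) (++-assoc u v [ c ]) ⟩
    rotate (length u) (u ++ v ∷ʳ c)   ≡⟨ rotate-++ u (v ∷ʳ c) ⟩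
    (v ∷ʳ c) ++ u                     ≡⟨ ++-assoc v [ c ] u ⟩
    v ++ c ∷ u                        ∎
    where open ≡-Reasoning

  rotate-+ : ∀ i j L → rotate (i + j) L ≡ rotate j (rotate i L)
  rotate-+ zero    j       L  = refl
  rotate-+ (suc i) zero    [] = refl
  rotate-+ (suc i) (suc j) [] = refl
  rotate-+ (suc i) j (x ∷ L)  = rotate-+ i j (L ∷ʳ x)

  rotation-refl : ∀ L → Rotation L L
  rotation-refl L = [] , L , refl , sym (++-identityʳ L)

  rotation-≡ : ∀ {L L′} → L ≡ L′ → Rotation L L′
  rotation-≡ {L} refl = rotation-refl L

  rotation-sym : ∀ {L L′} → Rotation L L′ → Rotation L′ L
  rotation-sym (u , v , eq , eq′) = v , u , eq′ , eq

  rotation-trans : ∀ {L L′ L″} → Rotation L L′ → Rotation L′ L″ → Rotation L L″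
  rotation-trans {L} {L′} {L″} (u , v , refl , refl) (u′ , v′ , eq , refl) =
    subst (Rotation L) composite (rotation-rotate (length u + length u′) L)
    where
    open ≡-Reasoning
    composite : rotate (length u + length u′) L ≡ L″
    composite = begin
      rotate (length u + length u′) (u ++ v)  ≡⟨ rotate-+ (length u) (length u′) (u ++ v) ⟩
      rotate (length u′) (rotate (length u) (u ++ v)) ≡⟨ cong (rotate (length u′)) (trans (rotate-++ u v) eq) ⟩
      rotate (length u′) (u′ ++ v′) ≡⟨ rotate-++ u′ v′ ⟩
      v′ ++ u′ ∎

  dropLast : List A → List A
  dropLast []          = []
  dropLast (x ∷ [])    = []
  dropLast (x ∷ y ∷ r) = x ∷ dropLast (y ∷ r)

  dropLast-∷ʳ : ∀ L x → dropLast (L ∷ʳ x) ≡ L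
  dropLast-∷ʳ []          x = refl
  dropLast-∷ʳ (c ∷ [])    x = refl
  dropLast-∷ʳ (c ∷ d ∷ L) x = cong (c ∷_) (dropLast-∷ʳ (d ∷ L) x)

  cyclicCore : List A → List A
  cyclicCore L = dropLast (trim L)

  cyclicCore-untrimmable : ∀ L {x} → ¬ Trimmable (L ∷ʳ x) → cyclicCore (L ∷ʳ x) ≡ L
  cyclicCore-untrimmable L {x} ¬t = trans (cong dropLast (trim-stop (L ∷ʳ x) ¬t)) (dropLast-∷ʳ L x)

  -- push x₀ (pushAll W [ x₀ ]) is the reduced form of x₀ W x₀; what cancels depends on whether x₀ is a or b.
  module _ {x₁ a b : A} (M : List A) (W-reduced : Reduced (x₁ ∷ a ∷ M ∷ʳ b ∷ʳ x₁)) where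

    private
      W : List A
      W = x₁ ∷ a ∷ M ∷ʳ b ∷ʳ x₁

      b≢x₁ : b ≢ x₁
      b≢x₁ refl = reduced-¬stutter (x₁ ∷ a ∷ M) (subst Reduced (∷ʳ-++ (x₁ ∷ a ∷ M) b [ x₁ ]) W-reduced)

      cyclicCore-W : a ≢ b → cyclicCore W ≡ x₁ ∷ a ∷ M ∷ʳ b
      cyclicCore-W a≢b = cyclicCore-untrimmable (x₁ ∷ a ∷ M ∷ʳ b) (a≢b ∘ trimmable-ends)

      pushAll-closing-backtrack : pushAll W [ b ] ≡ x₁ ∷ a ∷ M ∷ʳ b
      pushAll-closing-backtrack = begin
        pushAll W [ b ]                            ≡⟨ pushAll-∷ʳ (x₁ ∷ a ∷ M ∷ʳ b) x₁ [ b ] ⟩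
        pushAll (x₁ ∷ a ∷ M ∷ʳ b) (push x₁ [ b ])   ≡⟨ cong (pushAll (x₁ ∷ a ∷ M ∷ʳ b)) (push-≢ [] (≢-sym b≢x₁)) ⟩
        pushAll (x₁ ∷ a ∷ M ∷ʳ b) (x₁ ∷ [ b ])     ≡⟨ pushAll-∷ʳ (x₁ ∷ a ∷ M) b (x₁ ∷ [ b ]) ⟩
        pushAll (x₁ ∷ a ∷ M) (push b (x₁ ∷ [ b ])) ≡⟨ cong (pushAll (x₁ ∷ a ∷ M)) (push-backtrack-∷-∷ [] b≢x₁) ⟩
        pushAll (x₁ ∷ a ∷ M) [ b ]                 ≡⟨ pushAll-of-reduced (x₁ ∷ a ∷ M) [ b ] prefix-reduced ⟩
        x₁ ∷ a ∷ M ∷ʳ b                            ∎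
        where
        open ≡-Reasoning
        prefix-reduced = reduced-++⁻ˡ (x₁ ∷ a ∷ M ∷ʳ b) [ x₁ ] W-reduced

      pushAll-closing : ∀ {x₀} → b ≢ x₀ → x₁ ≢ x₀ → pushAll W [ x₀ ] ≡ W ∷ʳ x₀
      pushAll-closing b≢x₀ x₁≢x₀ = pushAll-of-reduced W _ (reduced-extend (x₁ ∷ a ∷ M) W-reduced b≢x₀ x₁≢x₀)

      conjugate-by-a≡b : a ≡ b → a ≢ x₁ → cyclicCore (push a (pushAll W [ a ])) ≡ cyclicCore W
      conjugate-by-a≡b refl a≢x₁ = begin
        cyclicCore (push a (pushAll W [ a ])) ≡⟨ cong (cyclicCore ∘ push a) pushAll-closing-backtrack ⟩
        cyclicCore (push a (x₁ ∷ a ∷ M ∷ʳ a)) ≡⟨ cong cyclicCore (push-backtrack-∷-∷ (M ∷ʳ a) a≢x₁) ⟩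
        dropLast (trim (a ∷ M ∷ʳ a))           ≡⟨ cong dropLast (trim-step x₁ a M x₁) ⟨
        cyclicCore W                           ∎
        where open ≡-Reasoning

      conjugate-by-b : a ≢ b → Rotation (cyclicCore (push b (pushAll W [ b ]))) (cyclicCore W)
      conjugate-by-b a≢b = subst₂ Rotation (sym core) (sym (cyclicCore-W a≢b)) ([ b ] , x₁ ∷ a ∷ M , refl , refl)
        where
        open ≡-Reasoning
        untrimmable : ¬ Trimmable (b ∷ x₁ ∷ a ∷ M ∷ʳ b)
        untrimmable t with trimmable-inner b (x₁ ∷ a ∷ M) b t
        ... | y , N , eq with ∷-injective eq
        ... | refl , aM≡Nx₁ = reduced-¬backtrack (x₁ ∷ N) (subst Reduced W≡ W-reduced)
          where
          W≡ : W ≡ (x₁ ∷ N) ++ x₁ ∷ b ∷ x₁ ∷ []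
          W≡ = trans (cong (λ R → x₁ ∷ R ∷ʳ b ∷ʳ x₁) aM≡Nx₁)
                     (cong (x₁ ∷_) (trans (∷ʳ-++ (N ∷ʳ x₁) b [ x₁ ]) (∷ʳ-++ N x₁ (b ∷ [ x₁ ]))))
        core : cyclicCore (push b (pushAll W [ b ])) ≡ b ∷ x₁ ∷ a ∷ M
        core = begin
          cyclicCore (push b (pushAll W [ b ])) ≡⟨ cong (cyclicCore ∘ push b) pushAll-closing-backtrack ⟩
          cyclicCore (push b (x₁ ∷ a ∷ M ∷ʳ b)) ≡⟨ cong cyclicCore (push-∷-∷ (M ∷ʳ b) b≢x₁ (≢-sym a≢b)) ⟩
          cyclicCore (b ∷ x₁ ∷ a ∷ M ∷ʳ b)      ≡⟨ cyclicCore-untrimmable (b ∷ x₁ ∷ a ∷ M) untrimmable ⟩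
          b ∷ x₁ ∷ a ∷ M                        ∎

      conjugate-by-a : a ≢ b → a ≢ x₁ → Rotation (cyclicCore (push a (pushAll W [ a ]))) (cyclicCore W)
      conjugate-by-a a≢b a≢x₁ = subst₂ Rotation (sym core) (sym (cyclicCore-W a≢b)) (a ∷ M ∷ʳ b , [ x₁ ] , refl , refl)
        where
        open ≡-Reasoning
        untrimmable : ¬ Trimmable (a ∷ M ∷ʳ b ∷ʳ x₁ ∷ʳ a)
        untrimmable t with trimmable-inner a (M ∷ʳ b ∷ʳ x₁) a t
        ... | y , N , eq with ∷ʳ-injective (M ∷ʳ b) (y ∷ N) eq
        ... | Mb≡x₁N , refl =
          reduced-¬backtrack [] (subst Reduced (cong (λ R → x₁ ∷ a ∷ R ∷ʳ x₁) Mb≡x₁N) W-reduced)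
        core : cyclicCore (push a (pushAll W [ a ])) ≡ a ∷ M ∷ʳ b ∷ʳ x₁
        core = begin
          cyclicCore (push a (pushAll W [ a ])) ≡⟨ cong (cyclicCore ∘ push a) (pushAll-closing (≢-sym a≢b) (≢-sym a≢x₁)) ⟩
          cyclicCore (push a (W ∷ʳ a))          ≡⟨ cong cyclicCore (push-backtrack-∷-∷ _ a≢x₁) ⟩
          cyclicCore (a ∷ M ∷ʳ b ∷ʳ x₁ ∷ʳ a)    ≡⟨ cyclicCore-untrimmable (a ∷ M ∷ʳ b ∷ʳ x₁) untrimmable ⟩
          a ∷ M ∷ʳ b ∷ʳ x₁                      ∎

      conjugate-by-other : ∀ {x₀} → x₀ ≢ a → x₀ ≢ b → x₀ ≢ x₁ →
                           cyclicCore (push x₀ (pushAll W [ x₀ ])) ≡ cyclicCore W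
      conjugate-by-other {x₀} x₀≢a x₀≢b x₀≢x₁ = begin
        cyclicCore (push x₀ (pushAll W [ x₀ ])) ≡⟨ cong (cyclicCore ∘ push x₀) (pushAll-closing b≢x₀ x₁≢x₀) ⟩
        cyclicCore (push x₀ (W ∷ʳ x₀))          ≡⟨ cong cyclicCore (push-∷-∷ _ x₀≢x₁ x₀≢a) ⟩
        dropLast (trim (x₀ ∷ W ∷ʳ x₀))          ≡⟨ cong dropLast (trim-step x₀ x₁ (a ∷ M ∷ʳ b) x₀) ⟩
        cyclicCore W                            ∎
        where
        open ≡-Reasoning
        b≢x₀ = ≢-sym x₀≢b
        x₁≢x₀ = ≢-sym x₀≢x₁

    cyclicCore-conjugate-long : ∀ x₀ → x₀ ≢ x₁ → Rotation (cyclicCore (push x₀ (pushAll W [ x₀ ]))) (cyclicCore W)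
    cyclicCore-conjugate-long x₀ x₀≢x₁ with x₀ ≟ a | x₀ ≟ b
    ... | yes refl | yes a≡b  = rotation-≡ (conjugate-by-a≡b a≡b x₀≢x₁)
    ... | yes refl | no a≢b   = conjugate-by-a a≢b x₀≢x₁
    ... | no x₀≢a  | yes refl = conjugate-by-b (≢-sym x₀≢a)
    ... | no x₀≢a  | no x₀≢b  = rotation-≡ (conjugate-by-other x₀≢a x₀≢b x₀≢x₁)

  reduced-closed-shape : ∀ {x₁} W t ws → Reduced W → W ≡ x₁ ∷ t → W ≡ ws ∷ʳ x₁ →
                         W ≡ [ x₁ ] ⊎ ∃₂ λ a M → ∃ λ b → W ≡ x₁ ∷ a ∷ M ∷ʳ b ∷ʳ x₁
  reduced-closed-shape {x₁} W t ws h refl eq with initLast t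
  ... | [] = inj₁ refl
  ... | t′ ∷ʳ′ c with ∷ʳ-injective (x₁ ∷ t′) ws eq
  ...   | _ , refl with t′
  ...     | [] = ⊥-elim (h refl)
  ...     | a ∷ t″ with initLast t″
  ...       | []       = ⊥-elim (proj₁ (proj₂ h) refl)
  ...       | M ∷ʳ′ b  = inj₂ (a , M , b , refl)

  conjugate-by-endpoint : ∀ {x} W t ws → Reduced W → W ≡ x ∷ t → W ≡ ws ∷ʳ x → push x (pushAll W [ x ]) ≡ W
  conjugate-by-endpoint {x} W t ws h eq eq′ = begin
    push x (pushAll W [ x ])          ≡⟨ cong (λ L → push x (pushAll L [ x ])) eq′ ⟩
    push x (pushAll (ws ∷ʳ x) [ x ])  ≡⟨ cong (push x) (pushAll-∷ʳ ws x [ x ]) ⟩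
    push x (pushAll ws (push x [ x ])) ≡⟨ cong (λ L → push x (pushAll ws L)) (push-≡ x []) ⟩
    push x (pushAll ws [ x ])         ≡⟨ cong (push x) (pushAll-of-reduced ws [ x ] (subst Reduced eq′ h)) ⟩
    push x (ws ∷ʳ x)                  ≡⟨ cong (push x) (trans (sym eq′) eq) ⟩
    push x (x ∷ t)                    ≡⟨ push-≡ x t ⟩
    x ∷ t                             ≡⟨ eq ⟨
    W                                 ∎
    where open ≡-Reasoning

  cyclicCore-conjugate : ∀ x₀ {x₁} W t ws → Reduced W → W ≡ x₁ ∷ t → W ≡ ws ∷ʳ x₁ →
                         Rotation (cyclicCore (push x₀ (pushAll W [ x₀ ]))) (cyclicCore W)
  cyclicCore-conjugate x₀ {x₁} W t ws h eq eq′ with x₀ ≟ x₁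
  ... | yes refl = rotation-≡ (cong cyclicCore (conjugate-by-endpoint W t ws h eq eq′))
  ... | no x₀≢x₁ with reduced-closed-shape W t ws h eq eq′
  ...   | inj₁ refl = rotation-≡ (cong cyclicCore (trans (cong (push x₀) (push-≢ [] (≢-sym x₀≢x₁)))
                                                      (trans (push-≢ _ x₀≢x₁) (pushPast-≡ x₀ x₁ []))))
  ...   | inj₂ (a , M , b , refl) = cyclicCore-conjugate-long M h x₀ x₀≢x₁

module _ (H : RGraph) where
  open RGraph H
  open FreeReduction (_≟ᶠ_ {n})

  ∼-sym : ∀ {x y} → _∼_ H x y → _∼_ H y x
  ∼-sym {x} {y} h = trans (adj-sym y x) h

  common-neighbour : TriangleFree H → ∀ {a x x′} → x ≢ x′ → _∼_ H x x′ →
                     _∼_ H a x → _∼_ H a x′ → a ≡ x ⊎ a ≡ x′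
  common-neighbour tf {a} {x} {x′} x≢x′ xx′ ax ax′ with a ≟ᶠ x | a ≟ᶠ x′
  ... | yes a≡x | _        = inj₁ a≡x
  ... | no _    | yes a≡x′ = inj₂ a≡x′
  ... | no a≢x  | no a≢x′  = ⊥-elim (tf a x x′ a≢x x≢x′ a≢x′ ax xx′ ax′)

  walk-++⁻ : ∀ p {c s} → IsWalk H (p ++ c ∷ s) → IsWalk H (c ∷ s)
  walk-++⁻ []          w          = w
  walk-++⁻ (d ∷ [])    (cons _ w) = w
  walk-++⁻ (d ∷ e ∷ p) (cons _ w) = walk-++⁻ (e ∷ p) w

  walk-replace : ∀ p {c s t} → IsWalk H (p ++ c ∷ s) → IsWalk H (c ∷ t) → IsWalk H (p ++ c ∷ t)
  walk-replace []          _          w′ = w′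
  walk-replace (d ∷ [])    (cons h _) w′ = cons h w′
  walk-replace (d ∷ e ∷ p) (cons h w) w′ = cons h (walk-replace (e ∷ p) w w′)

  walk-∷ʳ⁻ : ∀ c L {d} → IsWalk H ((c ∷ L) ∷ʳ d) → IsWalk H (c ∷ L)
  walk-∷ʳ⁻ c []      _          = single c
  walk-∷ʳ⁻ c (e ∷ L) (cons h w) = cons h (walk-∷ʳ⁻ e L w)

  starts-++ : ∀ {r} p {c s t} → Starts H r (p ++ c ∷ s) → Starts H r (p ++ c ∷ t)
  starts-++ []      {t = t} (_ , refl) = t , refl
  starts-++ (d ∷ p) {t = t} (_ , refl) = p ++ _ ∷ t , refl

  ends-++⁻ : ∀ {r} p {c s} → Ends H r (p ++ c ∷ s) → Ends H r (c ∷ s)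
  ends-++⁻ []      e              = e
  ends-++⁻ (d ∷ p) ([] , eq)     with () ← ++-conicalʳ p _ (proj₂ (∷-injective eq))
  ends-++⁻ (d ∷ p) (_ ∷ ys , eq) = ends-++⁻ p (ys , proj₂ (∷-injective eq))

  ends-++⁺ : ∀ {r} p {s} → Ends H r s → Ends H r (p ++ s)
  ends-++⁺ {r} p (ys , refl) = p ++ ys , sym (++-assoc p ys [ r ])

  walkFrom-replace : ∀ {r r′} p {c s t} → IsWalkFrom H r r′ (p ++ c ∷ s) → IsWalk H (c ∷ t) →
                     (Ends H r′ (c ∷ s) → Ends H r′ (c ∷ t)) → IsWalkFrom H r r′ (p ++ c ∷ t)
  walkFrom-replace p (w , st , en) w′ f = walk-replace p w w′ , starts-++ p st , ends-++⁺ p (f (ends-++⁻ p en))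

  walkFrom-unstutter : ∀ {r r′} p {x q} → IsWalkFrom H r r′ (p ++ x ∷ x ∷ q) → IsWalkFrom H r r′ (p ++ x ∷ q)
  walkFrom-unstutter p {x} W with walk-++⁻ p (proj₁ W)
  ... | cons _ w = walkFrom-replace p W w (ends-++⁻ [ x ])

  walkFrom-flatten : ∀ {r r′} p {a b q} → IsWalkFrom H r r′ (p ++ a ∷ b ∷ a ∷ q) →
                     IsWalkFrom H r r′ (p ++ a ∷ a ∷ a ∷ q)
  walkFrom-flatten p {a} {b} W with walk-++⁻ p (proj₁ W)
  ... | cons _ (cons _ w) = walkFrom-replace p W (cons (adj-refl a) (cons (adj-refl a) w))
                                             (λ e → ends-++⁺ (a ∷ a ∷ []) (ends-++⁻ (a ∷ b ∷ []) e))

  move-interior : ∀ p {a x x′ z q} → _∼_ H x′ x → Move H (p ++ a ∷ x ∷ z ∷ q) (p ++ a ∷ x′ ∷ z ∷ q)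
  move-interior []               {a} {x} {x′} {z} {q} h = P2 a [] x x′ z q h
  move-interior (y ∷ p)          {a} {x} {x′} {z} {q} h =
    subst₂ (Move H) (cong (y ∷_) (∷ʳ-++ p a _)) (cong (y ∷_) (∷ʳ-++ p a _)) (P2 y (p ∷ʳ a) x x′ z q h)

  split-last : ∀ (y : V H) p → ∃₂ λ p₀ a → y ∷ p ≡ p₀ ∷ʳ a
  split-last y p with initLast p
  ... | []       = [] , y , refl
  ... | p′ ∷ʳ′ a = y ∷ p′ , a , refl

  reduce-replace-interior : TriangleFree H → ∀ p {a x x′ z q} → IsWalk H (p ++ a ∷ x ∷ z ∷ q) →
                            IsWalk H (p ++ a ∷ x′ ∷ z ∷ q) → _∼_ H x′ x →
                            reduce (p ++ a ∷ x ∷ z ∷ q) ≡ reduce (p ++ a ∷ x′ ∷ z ∷ q)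
  reduce-replace-interior tf p {a} {x} {x′} {z} {q} w w′ x′x with x ≟ᶠ x′ | walk-++⁻ p w | walk-++⁻ p w′
  ... | yes refl | _ | _ = refl
  ... | no x≢x′ | cons ax (cons xz _) | cons ax′ (cons x′z _) = begin
    reduce (p ++ a ∷ x ∷ z ∷ q)                      ≡⟨ reduce-++ p _ ⟩
    pushAll p (push a (push x (push z (reduce q))))  ≡⟨ cong (pushAll p) (push-replace-middle (reduce q) (reduce-reduced q)
                                                           (common-neighbour tf x≢x′ xx′ ax ax′)
                                                           (common-neighbour tf x≢x′ xx′ (∼-sym xz) (∼-sym x′z))) ⟩
    pushAll p (push a (push x′ (push z (reduce q)))) ≡⟨ reduce-++ p _ ⟨
    reduce (p ++ a ∷ x′ ∷ z ∷ q)                     ∎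
    where
    open ≡-Reasoning
    xx′ = ∼-sym x′x

  reduce-move : TriangleFree H → ∀ {X Y} → Move H X Y → IsWalk H X → IsWalk H Y → reduce X ≡ reduce Y
  reduce-move tf (P1 p x q) _ _ =
    trans (reduce-++ p _) (trans (cong (pushAll p) (sym (push-idem x (reduce q)))) (sym (reduce-++ p _)))
  reduce-move tf (P2 y p x x′ z q x′x) w w′ with split-last y p
  ... | p₀ , a , y∷p≡ = begin
    reduce ((y ∷ p) ++ x ∷ z ∷ q)  ≡⟨ cong reduce (regroup x) ⟩
    reduce (p₀ ++ a ∷ x ∷ z ∷ q)   ≡⟨ reduce-replace-interior tf p₀ (subst (IsWalk H) (regroup x) w)
                                                                   (subst (IsWalk H) (regroup x′) w′) x′x ⟩
    reduce (p₀ ++ a ∷ x′ ∷ z ∷ q)  ≡⟨ cong reduce (regroup x′) ⟨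
    reduce ((y ∷ p) ++ x′ ∷ z ∷ q) ∎
    where
    open ≡-Reasoning
    regroup : ∀ v → (y ∷ p) ++ v ∷ z ∷ q ≡ p₀ ++ a ∷ v ∷ z ∷ q
    regroup v = trans (cong (_++ v ∷ z ∷ q) y∷p≡) (∷ʳ-++ p₀ a _)

  cyclicWord : List (V H) → List (V H)
  cyclicWord D = cyclicCore (reduce D)

  cyclicWord-reduce : ∀ {X Y} → Reduce H X Y → Rotation (cyclicWord X) (cyclicWord Y)
  cyclicWord-reduce (x₀ , refl , x₁ , _ , (ys , refl) , (zs , Y≡zs∷ʳx₁))
    with push-head x₁ (reduce ys) | reduce-last zs x₁
  ... | t , t≡ | ws , ws≡ =
    subst (λ L → Rotation (cyclicCore L) (cyclicWord (x₁ ∷ ys))) (sym reduce-conjugate)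
          (cyclicCore-conjugate x₀ (reduce (x₁ ∷ ys)) t ws (reduce-reduced (x₁ ∷ ys)) t≡
                                (trans (cong reduce Y≡zs∷ʳx₁) ws≡))
    where
    reduce-conjugate : reduce (x₀ ∷ (x₁ ∷ ys) ∷ʳ x₀) ≡ push x₀ (pushAll (reduce (x₁ ∷ ys)) [ x₀ ])
    reduce-conjugate = cong (push x₀) (trans (reduce-++ (x₁ ∷ ys) [ x₀ ]) (pushAll-reduce (x₁ ∷ ys) [ x₀ ] tt))

  cyclicWord-edge : TriangleFree H → ∀ {X Y} → PiEdge H X Y → Rotation (cyclicWord X) (cyclicWord Y)
  cyclicWord-edge tf (_ , _ , inj₁ (_ , (wX , _) , (wY , _) , inj₁ m)) =
    rotation-≡ (cong cyclicCore (reduce-move tf m wX wY))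
  cyclicWord-edge tf (_ , _ , inj₁ (_ , (wX , _) , (wY , _) , inj₂ m)) =
    rotation-≡ (cong cyclicCore (sym (reduce-move tf m wY wX)))
  cyclicWord-edge tf (_ , _ , inj₂ (inj₁ rd)) = cyclicWord-reduce rd
  cyclicWord-edge tf (_ , _ , inj₂ (inj₂ rd)) = rotation-sym (cyclicWord-reduce rd)

  cyclicWord-component : TriangleFree H → ∀ {X Y} → SameComponent H X Y → Rotation (cyclicWord X) (cyclicWord Y)
  cyclicWord-component tf ε        = rotation-refl _
  cyclicWord-component tf (e ◅ es) = rotation-trans (cyclicWord-edge tf e) (cyclicWord-component tf es)

  piEdge-move : ∀ {r X Y} → IsWalkFrom H r r X → IsWalkFrom H r r Y → Move H X Y ⊎ Move H Y X → PiEdge H X Y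
  piEdge-move wX wY m = (_ , wX) , (_ , wY) , inj₁ (_ , wX , wY , m)

  freeReduced-minimal : ∀ {A E} → FreeReduced H A → IsClosedWalk H E → SameComponent H A E → ¬ length E < length A
  freeReduced-minimal (_ , minimal) closed path = ≤⇒≯ (minimal _ closed path)

  length-++-< : ∀ p {s t : List (V H)} → length s < length t → length (p ++ s) < length (p ++ t)
  length-++-< p h = subst₂ _<_ (sym (length-++ p)) (sym (length-++ p)) (+-monoʳ-< (length p) h)

  freeReduced-¬stutter : ∀ {A} → FreeReduced H A → ∀ p x q → A ≢ p ++ x ∷ x ∷ q
  freeReduced-¬stutter fr@((r , wA) , _) p x q refl =
    freeReduced-minimal fr (r , wE) (piEdge-move wA wE (inj₂ (P1 p x q)) ◅ ε) (length-++-< p ≤-refl)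
    where
    wE = walkFrom-unstutter p wA

  -- p a b a q  →  p a a a q  →  p a a q  →  p a q
  freeReduced-¬backtrack : ∀ {A} → FreeReduced H A → ∀ p a b q → A ≢ p ++ a ∷ b ∷ a ∷ q
  freeReduced-¬backtrack fr@((r , wA) , _) p a b q refl with walk-++⁻ p (proj₁ wA)
  ... | cons ab _ =
    freeReduced-minimal fr (r , w₃)
      (piEdge-move wA w₁ (inj₁ (move-interior p ab)) ◅ piEdge-move w₁ w₂ (inj₂ (P1 p a (a ∷ q))) ◅
       piEdge-move w₂ w₃ (inj₂ (P1 p a q)) ◅ ε)
      (length-++-< p (s≤s (s≤s (n≤1+n _))))
    where
    w₁ = walkFrom-flatten p wA
    w₂ = walkFrom-unstutter p w₁
    w₃ = walkFrom-unstutter p w₂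

  freeReduced-reduced : ∀ {A} → FreeReduced H A → Reduced A
  freeReduced-reduced {A} fr = reduced-intro A (freeReduced-¬stutter fr) (freeReduced-¬backtrack fr)

  freeReduced-¬trimmable : ∀ {A} → FreeReduced H A → ¬ Trimmable A
  freeReduced-¬trimmable fr@((r , cons _ w , (_ , refl) , (zs , A≡zs∷ʳr)) , _) (x₀ , x₁ , M , y₀ , refl)
    with refl ← ∷ʳ-injectiveʳ (x₀ ∷ x₁ ∷ M ∷ʳ x₁) zs A≡zs∷ʳr =
    freeReduced-minimal fr closed (edge ◅ ε) shorter
    where
    Y = x₁ ∷ M ∷ʳ x₁
    closed : IsClosedWalk H Y
    closed = x₁ , walk-∷ʳ⁻ x₁ (M ∷ʳ x₁) w , (M ∷ʳ x₁ , refl) , (x₁ ∷ M , refl)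
    edge : PiEdge H (x₀ ∷ Y ∷ʳ x₀) Y
    edge = proj₁ fr , closed , inj₂ (inj₁ (x₀ , refl , closed))
    shorter : length Y < length (x₀ ∷ Y ∷ʳ x₀)
    shorter = subst (λ n → length Y < suc n) (sym (length-∷ʳ Y x₀)) (m<n⇒m<1+n (n<1+n (length Y)))

  freeReduced-shape : ∀ {A} → FreeReduced H A → ¬ Contractible H A → ∃₂ λ r L → A ≡ (r ∷ L) ∷ʳ r
  freeReduced-shape ((r , _ , _ , [] , refl) , _) ¬contractible =
    ⊥-elim (¬contractible (r , (single r , ([] , refl) , ([] , refl)) , ε))
  freeReduced-shape ((r , _ , (_ , refl) , z ∷ L , A≡) , _) _ with refl ← ∷-injectiveˡ A≡ = r , L , A≡

  cyclicWord-freeReduced : ∀ {A} → FreeReduced H A → ¬ Contractible H A →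
                           ∃₂ λ r L → A ≡ (r ∷ L) ∷ʳ r × cyclicWord A ≡ r ∷ L
  cyclicWord-freeReduced fr ¬contractible with freeReduced-shape fr ¬contractible
  ... | r , L , refl = r , L , refl , (begin
    cyclicCore (reduce ((r ∷ L) ∷ʳ r)) ≡⟨ cong cyclicCore (reduce-of-reduced _ (freeReduced-reduced fr)) ⟩
    cyclicCore ((r ∷ L) ∷ʳ r)          ≡⟨ cyclicCore-untrimmable (r ∷ L) (freeReduced-¬trimmable fr) ⟩
    r ∷ L                              ∎)
    where open ≡-Reasoning

  rotation⇒cyclicShift : ∀ {A B r s L L′} → A ≡ (r ∷ L) ∷ʳ r → B ≡ (s ∷ L′) ∷ʳ s →
                         Rotation (r ∷ L) (s ∷ L′) → CyclicShift H A B
  rotation⇒cyclicShift {r = r} {L = L} refl refl (u , [] , eq , refl)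
    with refl ← trans eq (++-identityʳ u) = [] , r , L , r , (_ , refl) , refl , refl
  rotation⇒cyclicShift {r = r} refl refl (u , x ∷ v , eq , refl) =
    u , x , v , r , (_ , refl) , trans (cong (_∷ʳ r) eq) (++-assoc u (x ∷ v) [ r ]) , cong (x ∷_) (++-assoc v u [ x ])

corollary5p4 : (H : RGraph) → TriangleFree H →
    (A B : List (V H)) →
    FreeReduced H A → ¬ Contractible H A →
    FreeReduced H B → ¬ Contractible H B →
    SameComponent H A B →
    CyclicShift H A B
corollary5p4 H tf A B frA ¬cA frB ¬cB path
  with cyclicWord-freeReduced H frA ¬cA | cyclicWord-freeReduced H frB ¬cB
... | r , L , A≡ , wordA | s , L′ , B≡ , wordB =
  rotation⇒cyclicShift H A≡ B≡ (subst₂ Rotation wordA wordB (cyclicWord-component H tf path))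
  where open FreeReduction (_≟ᶠ_ {RGraph.n H})
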